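{- Every $\mathsf{CSGL}$ proof of a tree sequent of the form $\vdash x:\phi$ can be transformed into an end-active $\mathsf{CSGL}$ proof of $\vdash x:\phi$.
   Context: Formulae: $\phi ::= p \mid \neg\phi \mid \phi\lor\phi \mid \Box\phi$. Fix a countably infinite set of labels $x,y,z,\dots$. A relational atom is $xRy$; a labeled formula is $x:\phi$. A set $\mathcal{T}$ of relational atoms is a tree if the directed graph with vertices its labels and edges $(x,y)$ for $xRy\in\mathcal{T}$ is a tree. A tree sequent is $\mathcal{T},\Gamma\vdash\Delta$ with $\mathcal{T}$ a tree, $\Gamma,\Delta$ finite multisets of labeled formulae, such that if $\mathcal{T}\neq\emptyset$ every label of $\Gamma,\Delta$ occurs in $\mathcal{T}$, and if $\mathcal{T}=\emptyset$ all formulae in $\Gamma,\Delta$ share one label. A label is a leaf if it is a leaf of $\mathcal{T}$ (or the unique label if $\mathcal{T}=\emptyset$); a label $x$ is a pre-leaf if every $y$ with $xRy\in\mathcal{T}$ is a leaf. $\mathsf{CSGL}$ operates on tree sequents with rules (premises before $\Rightarrow$): $\mathsf{id_1}$: $\Rightarrow\mathcal{T},\Gamma,x:p\vdash x:p,\Delta$; $\mathsf{id_2}$: $\Rightarrow\mathcal{T},\Gamma,x:\Box\phi\vdash x:\Box\phi,\Delta$; $\neg\mathsf{L}$: $\mathcal{T},\Gamma\vdash x:\phi,\Delta\Rightarrow\mathcal{T},\Gamma,x:\neg\phi\vdash\Delta$; $\neg\mathsf{R}$: $\mathcal{T},\Gamma,x:\phi\vdash\Delta\Rightarrow\mathcal{T},\Gamma\vdash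 x:\neg\phi,\Delta$; $\lor\mathsf{L}$: $\mathcal{T},\Gamma,x:\phi\vdash\Delta$ and $\mathcal{T},\Gamma,x:\psi\vdash\Delta\Rightarrow\mathcal{T},\Gamma,x:\phi\lor\psi\vdash\Delta$; $\lor\mathsf{R}$: $\mathcal{T},\Gamma\vdash x:\phi,x:\psi,\Delta\Rightarrow\mathcal{T},\Gamma\vdash x:\phi\lor\psi,\Delta$; $\Box\mathsf{L}$: $\mathcal{T},xRy,\Gamma,x:\Box\phi,y:\phi\vdash\Delta\Rightarrow\mathcal{T},xRy,\Gamma,x:\Box\phi\vdash\Delta$; $\mathsf{4L}$: $\mathcal{T},xRy,\Gamma,x:\Box\phi,y:\Box\phi\vdash\Delta\Rightarrow\mathcal{T},xRy,\Gamma,x:\Box\phi\vdash\Delta$; $\Box\mathsf{R}$: $\mathcal{T},xRy,\Gamma,y:\Box\phi\vdash y:\phi,\Delta\Rightarrow\mathcal{T},\Gamma\vdash x:\Box\phi,\Delta$, provided $y$ does not occur in the conclusion. A proof is a finite tree of tree sequents built by these rules with all leaves conclusions of $\mathsf{id_1}$ or $\mathsf{id_2}$. Local rules: $\neg\mathsf{L},\neg\mathsf{R},\lor\mathsf{L},\lor\mathsf{R}$; propagation rules: $\Box\mathsf{L},\mathsf{4L}$. The principal label is the label $x$ of the principal formula in the conclusion; for $\Box\mathsf{L},\mathsf{4L}$ the auxiliary label is $y$. A proof is end-active if: (1) the principal label of every $\mathsf{id_1}$, $\mathsf{id_2}$ instance is a leaf; (2) the principal label of every local rule instance is a leaf; (3)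 in every propagation rule instance the principal label is a pre-leaf and the auxiliary label is a leaf (no condition on $\Box\mathsf{R}$). -}

module Defs where

open import Data.Nat using (ℕ)
open import Data.Product using (Σ; _×_; _,_; ∃)
open import Data.Sum using (_⊎_)
open import Data.List using (List; []; _∷_; _++_; map; concatMap)
open import Data.List.Membership.Propositional using (_∈_; _∉_)
open import Data.List.Relation.Unary.All using (All)
open import Data.List.Relation.Binary.Permutation.Propositional using (_↭_)
open import Relation.Binary.PropositionalEquality using (_≡_; _≢_)
open import Relation.Nullary using (¬_)

data Fm : Set where
  var  : ℕ → Fm
  ¬'_  : Fm → Fm
  _∨'_ : Fm → Fm → Fm
  □_   : Fm → Fm

infix 30 ¬'_ □_
infixr 25 _∨'_

Label : Set
Label = ℕ

-- Relational atom xRy is the pair (x , y).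
RAtom : Set
RAtom = Label × Label

infix 10 _∶_
record LFm : Set where
  constructor _∶_
  field
    lab : Label
    fm  : Fm
open LFm public

-- Sequent  T , Γ ⊢ Δ  (Γ, Δ multisets represented as lists; all rules are
-- stated up to permutation (_↭_), so list order is irrelevant).
record Seq : Set where
  constructor ⟨_,_⊢_⟩
  field
    rel : List RAtom
    ant : List LFm
    suc : List LFm
open Seq public

vertices : List RAtom → List Label
vertices = concatMap (λ { (a , b) → a ∷ b ∷ [] })

data Reach (T : List RAtom) : Label → Label → Set where
  here  : ∀ {u} → Reach T u u
  there : ∀ {u w v} → (u , w) ∈ T → Reach T w v → Reach T u v

-- T = [] (empty graph) is allowed,
-- as in the definition of tree sequents.
IsTree : List RAtom → Set
IsTree T =
  T ≡ [] ⊎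
  Σ Label λ r →
    r ∈ vertices T ×
    (∀ u → (u , r) ∉ T) ×
    (∀ v → v ∈ vertices T → v ≢ r →
       Σ Label λ u → (u , v) ∈ T × (∀ u' → (u' , v) ∈ T → u' ≡ u)) ×
    (∀ v → v ∈ vertices T → Reach T r v)

labels : Seq → List Label
labels S = map lab (ant S ++ suc S)

IsTreeSeq : Seq → Set
IsTreeSeq S =
  IsTree (rel S) ×
  (¬ (rel S ≡ []) → All (λ l → l ∈ vertices (rel S)) (labels S)) ×
  (rel S ≡ [] → ∀ a b → a ∈ labels S → b ∈ labels S → a ≡ b)

Occurs : Label → Seq → Set
Occurs y S = y ∈ vertices (rel S) ⊎ y ∈ labels S

IsLeaf : Seq → Label → Set
IsLeaf S x =
  (x ∈ vertices (rel S) × (∀ y → (x , y) ∉ rel S)) ⊎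
  (rel S ≡ [] × x ∈ labels S)

IsPreLeaf : Seq → Label → Set
IsPreLeaf S x = ∀ y → (x , y) ∈ rel S → IsLeaf S y

data Proof : Seq → Set where
  id₁ : ∀ {T Γ Δ Γ' Δ' x p} →
        IsTreeSeq ⟨ T , Γ ⊢ Δ ⟩ →
        Γ ↭ (x ∶ var p) ∷ Γ' → Δ ↭ (x ∶ var p) ∷ Δ' →
        Proof ⟨ T , Γ ⊢ Δ ⟩
  id₂ : ∀ {T Γ Δ Γ' Δ' x φ} →
        IsTreeSeq ⟨ T , Γ ⊢ Δ ⟩ →
        Γ ↭ (x ∶ □ φ) ∷ Γ' → Δ ↭ (x ∶ □ φ) ∷ Δ' →
        Proof ⟨ T , Γ ⊢ Δ ⟩
  ¬L : ∀ {T Γ Δ Γ' x φ} →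
        IsTreeSeq ⟨ T , Γ ⊢ Δ ⟩ →
        Γ ↭ (x ∶ ¬' φ) ∷ Γ' →
        Proof ⟨ T , Γ' ⊢ (x ∶ φ) ∷ Δ ⟩ →
        Proof ⟨ T , Γ ⊢ Δ ⟩
  ¬R : ∀ {T Γ Δ Δ' x φ} →
        IsTreeSeq ⟨ T , Γ ⊢ Δ ⟩ →
        Δ ↭ (x ∶ ¬' φ) ∷ Δ' →
        Proof ⟨ T , (x ∶ φ) ∷ Γ ⊢ Δ' ⟩ →
        Proof ⟨ T , Γ ⊢ Δ ⟩
  ∨L : ∀ {T Γ Δ Γ' x φ ψ} →
        IsTreeSeq ⟨ T , Γ ⊢ Δ ⟩ →
        Γ ↭ (x ∶ (φ ∨' ψ)) ∷ Γ' →
        Proof ⟨ T , (x ∶ φ) ∷ Γ' ⊢ Δ ⟩ →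
        Proof ⟨ T , (x ∶ ψ) ∷ Γ' ⊢ Δ ⟩ →
        Proof ⟨ T , Γ ⊢ Δ ⟩
  ∨R : ∀ {T Γ Δ Δ' x φ ψ} →
        IsTreeSeq ⟨ T , Γ ⊢ Δ ⟩ →
        Δ ↭ (x ∶ (φ ∨' ψ)) ∷ Δ' →
        Proof ⟨ T , Γ ⊢ (x ∶ φ) ∷ (x ∶ ψ) ∷ Δ' ⟩ →
        Proof ⟨ T , Γ ⊢ Δ ⟩
  □L : ∀ {T Γ Δ x y φ} →
        IsTreeSeq ⟨ T , Γ ⊢ Δ ⟩ →
        (x , y) ∈ T → (x ∶ □ φ) ∈ Γ →
        Proof ⟨ T , (y ∶ φ) ∷ Γ ⊢ Δ ⟩ →
        Proof ⟨ T , Γ ⊢ Δ ⟩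
  4L : ∀ {T Γ Δ x y φ} →
        IsTreeSeq ⟨ T , Γ ⊢ Δ ⟩ →
        (x , y) ∈ T → (x ∶ □ φ) ∈ Γ →
        Proof ⟨ T , (y ∶ □ φ) ∷ Γ ⊢ Δ ⟩ →
        Proof ⟨ T , Γ ⊢ Δ ⟩
  □R : ∀ {T Γ Δ Δ' x y φ} →
        IsTreeSeq ⟨ T , Γ ⊢ Δ ⟩ →
        Δ ↭ (x ∶ □ φ) ∷ Δ' →
        ¬ Occurs y ⟨ T , Γ ⊢ Δ ⟩ →
        Proof ⟨ (x , y) ∷ T , (y ∶ □ φ) ∷ Γ ⊢ (y ∶ φ) ∷ Δ' ⟩ →
        Proof ⟨ T , Γ ⊢ Δ ⟩

EndActive : ∀ {S} → Proof S → Set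
EndActive {S} (id₁ {x = x} _ _ _) = IsLeaf S x
EndActive {S} (id₂ {x = x} _ _ _) = IsLeaf S x
EndActive {S} (¬L {x = x} _ _ d) = IsLeaf S x × EndActive d
EndActive {S} (¬R {x = x} _ _ d) = IsLeaf S x × EndActive d
EndActive {S} (∨L {x = x} _ _ d e) = IsLeaf S x × EndActive d × EndActive e
EndActive {S} (∨R {x = x} _ _ d) = IsLeaf S x × EndActive d
EndActive {S} (□L {x = x} {y = y} _ _ _ d) = IsPreLeaf S x × IsLeaf S y × EndActive d
EndActive {S} (4L {x = x} {y = y} _ _ _ d) = IsPreLeaf S x × IsLeaf S y × EndActive d
EndActive {S} (□R _ _ _ d) = EndActive d

{-# OPTIONS --safe #-}
-- The proof is semantic. CSGL is sound for finite tree models, in which □φ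
-- holds at a node iff φ holds at all its proper descendants, and □φ fails iff
-- some descendant refutes φ but forces □φ (Löb). Conversely, root-first proof
-- search that only ever works at the leaf of a chain of labels yields either an
-- end-active proof or a finite tree countermodel: local rules decompose the
-- formulas at the leaf; once only atoms and boxes remain, either an axiom
-- applies, or each □φ on the right is tried by □R to a fresh leaf, after □L and
-- 4L have copied B and □B there from the pre-leaf for every □B on the left. If
-- all these attempts fail, their countermodels become the children of a
-- countermodel of the leaf. The search terminates because every □R step adds
-- to the left a boxed subformula of the end formula that was not there before.
-- The given proof rules out a countermodel of ⊢ x : φ, so the search returns an
-- end-active proof.
module Submission where

open import Defs hiding (suc)
open import Data.Bool using (Bool; true; false)
open import Data.Empty using (⊥-elim)
open import Data.List using (List; []; _∷_; _++_; map; length; filter)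
open import Data.List.Properties using (map-++; filter-notAll)
open import Data.List.Membership.Propositional using (_∈_; _∉_; find; lose)
open import Data.List.Membership.Propositional.Properties
  using (∈-map⁺; ∈-++⁺ˡ; ∈-++⁺ʳ; ∈-++⁻; ∈-filter⁺)
open import Data.List.Relation.Binary.Subset.Propositional using (_⊆_)
open import Data.List.Relation.Unary.All using (All; []; _∷_; lookup; tabulate)
import Data.List.Relation.Unary.All as All
import Data.List.Relation.Unary.All.Properties as All
open import Data.List.Relation.Unary.Any using (Any; here; there; any?)
import Data.List.Relation.Unary.Any as Any
open import Data.List.Relation.Binary.Permutation.Propositional
  using (_↭_; ↭-refl; ↭-prep; ↭-swap; ↭-trans; ↭-sym)
import Data.List.Relation.Binary.Permutation.Propositional.Properties as ↭
open import Data.Nat using (ℕ; zero; suc; _+_; _≤_; _<_; _≤′_; ≤′-reflexive; ≤′-step; s≤s; _≟_)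
open import Data.Nat.Induction using (<-wellFounded)
open import Data.Nat.ListAction using (sum)
open import Data.Nat.ListAction.Properties using (sum-↭; sum-++)
open import Data.Nat.Properties
  using (≤-refl; ≤-reflexive; ≤-trans; ≤-antisym; <⇒≤; ≤′⇒≤; ≤⇒≤′; ≤∧≢⇒<; 1+n≰n; suc-injective;
         m≤m+n; m≤n+m; m≤n⇒m≤1+n; m≤n⇒m<n∨m≡n; +-monoˡ-<; +-identityʳ; module ≤-Reasoning)
open import Data.Product using (Σ; ∃; _×_; _,_; proj₁; proj₂; uncurry)
open import Data.Sum using (_⊎_; inj₁; inj₂)
import Data.Sum as Sum
open import Function using (_∘_; id)
open import Induction.WellFounded using (Acc; acc)
open import Relation.Binary.Definitions using (DecidableEquality)
open import Relation.Binary.PropositionalEquality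
  using (_≡_; _≢_; refl; sym; trans; cong; cong₂; subst; subst₂)
open import Relation.Nullary using (¬_; yes; no; does)
open import Relation.Nullary.Decidable using (map′; _×-dec_; ¬?; dec-true; dec-false)

↭-pull : ∀ {A : Set} {x y : A} {xs ys} → xs ↭ x ∷ ys → y ∷ xs ↭ x ∷ y ∷ ys
↭-pull p = ↭-trans (↭-prep _ p) (↭-swap _ _ ↭-refl)

∈⇒↭ : ∀ {A : Set} {x : A} {xs} → x ∈ xs → ∃ λ ys → xs ↭ x ∷ ys
∈⇒↭ (here refl) = _ , ↭-refl
∈⇒↭ (there x∈) = let _ , p = ∈⇒↭ x∈ in _ , ↭-pull p

↭-head∈ : ∀ {A : Set} {x : A} {xs ys} → xs ↭ x ∷ ys → x ∈ xs
↭-head∈ p = ↭.∈-resp-↭ (↭-sym p) (here refl)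

left-principal : ∀ {A : Set} {Γ Γ′ Δ : List A} {χ} → Γ ↭ χ ∷ Γ′ → Γ ++ Δ ↭ χ ∷ Γ′ ++ Δ
left-principal {Δ = Δ} p = ↭.++⁺ʳ Δ p

right-principal : ∀ {A : Set} {Γ Δ Δ′ : List A} {χ} → Δ ↭ χ ∷ Δ′ → Γ ++ Δ ↭ χ ∷ Γ ++ Δ′
right-principal {Γ = Γ} {Δ′ = Δ′} p = ↭-trans (↭.++⁺ˡ Γ p) (↭.shift _ Γ Δ′)

all-or-escape : ∀ {A X : Set} {P : A → Set} as → (∀ {a} → a ∈ as → X ⊎ P a) → X ⊎ All P as
all-or-escape [] _ = inj₂ []
all-or-escape (_ ∷ as) f with f (here refl) | all-or-escape as (f ∘ there)
... | inj₁ x | _       = inj₁ x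
... | inj₂ _ | inj₁ x  = inj₁ x
... | inj₂ p | inj₂ ps = inj₂ (p ∷ ps)

reach-snoc : ∀ {T u w v} → Reach T u w → (w , v) ∈ T → Reach T u v
reach-snoc here e = there e here
reach-snoc (there e r) e′ = there e (reach-snoc r e′)

source∈vertices : ∀ {T a b} → (a , b) ∈ T → a ∈ vertices T
source∈vertices {(_ , _) ∷ T} (here refl) = here refl
source∈vertices {(_ , _) ∷ T} (there e) = there (there (source∈vertices e))

target∈vertices : ∀ {T a b} → (a , b) ∈ T → b ∈ vertices T
target∈vertices {(_ , _) ∷ T} (here refl) = there (here refl)
target∈vertices {(_ , _) ∷ T} (there e) = there (there (target∈vertices e))

∈-vertices⁻ : ∀ T {v} → v ∈ vertices T → ∃ λ w → (v , w) ∈ T ⊎ (w , v) ∈ T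
∈-vertices⁻ ((a , b) ∷ T) (here refl) = b , inj₁ (here refl)
∈-vertices⁻ ((a , b) ∷ T) (there (here refl)) = a , inj₂ (here refl)
∈-vertices⁻ ((a , b) ∷ T) (there (there v∈)) with ∈-vertices⁻ T v∈
... | w , inj₁ e = w , inj₁ (there e)
... | w , inj₂ e = w , inj₂ (there e)

-- Finite tree models

data Tree : Set where
  node : (ℕ → Bool) → List Tree → Tree

infix 4 _≺_ _⊩_ _⊮_

data _≺_ : Tree → Tree → Set where
  child : ∀ {t v ts} → t ∈ ts → t ≺ node v ts
  below : ∀ {s t v ts} → t ∈ ts → s ≺ t → s ≺ node v ts

-- Forcing and refutation are defined side by side rather than as each other's
-- negation; soundness only needs that they exclude each other (⊩-⊮).
-- A refutation of □φ names a deepest descendant refuting φ.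
data _⊩_ : Tree → Fm → Set
data _⊮_ : Tree → Fm → Set

data _⊩_ where
  ⊩-var : ∀ {v ts p} → v p ≡ true → node v ts ⊩ var p
  ⊩-¬   : ∀ {t φ} → t ⊮ φ → t ⊩ ¬' φ
  ⊩-∨ˡ  : ∀ {t φ ψ} → t ⊩ φ → t ⊩ φ ∨' ψ
  ⊩-∨ʳ  : ∀ {t φ ψ} → t ⊩ ψ → t ⊩ φ ∨' ψ
  ⊩-□   : ∀ {v ts φ} → All (λ s → s ⊩ φ × s ⊩ □ φ) ts → node v ts ⊩ □ φ

data _⊮_ where
  ⊮-var : ∀ {v ts p} → v p ≡ false → node v ts ⊮ var p
  ⊮-¬   : ∀ {t φ} → t ⊩ φ → t ⊮ ¬' φ
  ⊮-∨   : ∀ {t φ ψ} → t ⊮ φ → t ⊮ ψ → t ⊮ φ ∨' ψ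
  ⊮-□   : ∀ {s t φ} → s ≺ t → s ⊮ φ → s ⊩ □ φ → t ⊮ □ φ

□-elim : ∀ {s t φ} → t ⊩ □ φ → s ≺ t → s ⊩ φ × s ⊩ □ φ
□-elim (⊩-□ h) (child s∈) = lookup h s∈
□-elim (⊩-□ h) (below t∈ s≺t) = □-elim (proj₂ (lookup h t∈)) s≺t

⊩-⊮ : ∀ φ {t} → t ⊩ φ → ¬ t ⊮ φ
⊩-⊮ (var p) (⊩-var h) (⊮-var h′) with () ← trans (sym h) h′
⊩-⊮ (¬' φ) (⊩-¬ h) (⊮-¬ h′) = ⊩-⊮ φ h′ h
⊩-⊮ (φ ∨' ψ) (⊩-∨ˡ h) (⊮-∨ h′ _) = ⊩-⊮ φ h h′
⊩-⊮ (φ ∨' ψ) (⊩-∨ʳ h) (⊮-∨ _ h′) = ⊩-⊮ ψ h h′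
⊩-⊮ (□ φ) h (⊮-□ s≺t h′ _) = ⊩-⊮ φ (proj₁ (□-elim h s≺t)) h′

-- Soundness

At : (Tree → Fm → Set) → (Label → Tree) → LFm → Set
At R f a = R (f (lab a)) (fm a)

At-agree : ∀ R {f g Γ} → (∀ {a} → a ∈ Γ → f (lab a) ≡ g (lab a)) → All (At R f) Γ → All (At R g) Γ
At-agree R f≡g h = tabulate λ {a} a∈ → subst (λ t → R t (fm a)) (f≡g a∈) (lookup h a∈)

Monotone : List RAtom → (Label → Tree) → Set
Monotone T f = ∀ {a b} → (a , b) ∈ T → f b ≺ f a

Refutes : (Label → Tree) → Seq → Set
Refutes f ⟨ T , Γ ⊢ Δ ⟩ = Monotone T f × All (At _⊩_ f) Γ × All (At _⊮_ f) Δ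

_[_↦_] : (Label → Tree) → Label → Tree → Label → Tree
(f [ y ↦ s ]) l with l ≟ y
... | yes _ = s
... | no  _ = f l

[↦]-≡ : ∀ f y s → (f [ y ↦ s ]) y ≡ s
[↦]-≡ f y s with y ≟ y
... | yes _  = refl
... | no y≢y = ⊥-elim (y≢y refl)

[↦]-≢ : ∀ f {y l} s → l ≢ y → (f [ y ↦ s ]) l ≡ f l
[↦]-≢ f {y} {l} s l≢y with l ≟ y
... | yes l≡y = ⊥-elim (l≢y l≡y)
... | no  _   = refl

□R-refutes : ∀ {T Γ Δ Δ′ x y φ f s} → Δ ↭ (x ∶ □ φ) ∷ Δ′ → ¬ Occurs y ⟨ T , Γ ⊢ Δ ⟩ →
             s ≺ f x → s ⊮ φ → s ⊩ □ φ → Refutes f ⟨ T , Γ ⊢ Δ ⟩ →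
             Refutes (f [ y ↦ s ]) ⟨ (x , y) ∷ T , (y ∶ □ φ) ∷ Γ ⊢ (y ∶ φ) ∷ Δ′ ⟩
□R-refutes {T} {Γ} {Δ} {Δ′} {x} {y} {φ} {f} {s} p y∉ s≺fx s⊮φ s⊩□φ (mono , hΓ , hΔ)
  with _ ∷ hΔ′ ← ↭.All-resp-↭ p hΔ
  = mono′ , subst (_⊩ □ φ) s≡gy s⊩□φ ∷ At-agree _⊩_ (fixed ∘ inΓ) hΓ
          , subst (_⊮ φ) s≡gy s⊮φ ∷ At-agree _⊮_ (fixed ∘ inΔ ∘ there) hΔ′
  where
  g = f [ y ↦ s ]
  s≡gy : s ≡ g y
  s≡gy = sym ([↦]-≡ f y s)
  fixed : ∀ {l} → Occurs l ⟨ T , Γ ⊢ Δ ⟩ → f l ≡ g l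
  fixed l∈ = sym ([↦]-≢ f s λ { refl → y∉ l∈ })
  inΓ : ∀ {a} → a ∈ Γ → Occurs (lab a) ⟨ T , Γ ⊢ Δ ⟩
  inΓ a∈ = inj₂ (∈-map⁺ lab (∈-++⁺ˡ a∈))
  inΔ : ∀ {a} → a ∈ (x ∶ □ φ) ∷ Δ′ → Occurs (lab a) ⟨ T , Γ ⊢ Δ ⟩
  inΔ a∈ = inj₂ (∈-map⁺ lab (∈-++⁺ʳ Γ (↭.∈-resp-↭ (↭-sym p) a∈)))
  mono′ : Monotone ((x , y) ∷ T) g
  mono′ (here refl) = subst₂ _≺_ s≡gy (fixed (inΔ (here refl))) s≺fx
  mono′ (there e) =
    subst₂ _≺_ (fixed (inj₁ (target∈vertices e))) (fixed (inj₁ (source∈vertices e))) (mono e)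

sound : ∀ {S f} → Proof S → ¬ Refutes f S
sound (id₁ _ pΓ pΔ) (_ , hΓ , hΔ)
  with h ∷ _ ← ↭.All-resp-↭ pΓ hΓ | h′ ∷ _ ← ↭.All-resp-↭ pΔ hΔ = ⊩-⊮ _ h h′
sound (id₂ _ pΓ pΔ) (_ , hΓ , hΔ)
  with h ∷ _ ← ↭.All-resp-↭ pΓ hΓ | h′ ∷ _ ← ↭.All-resp-↭ pΔ hΔ = ⊩-⊮ _ h h′
sound (¬L _ p d) (mono , hΓ , hΔ)
  with ⊩-¬ h ∷ hΓ′ ← ↭.All-resp-↭ p hΓ = sound d (mono , hΓ′ , h ∷ hΔ)
sound (¬R _ p d) (mono , hΓ , hΔ)
  with ⊮-¬ h ∷ hΔ′ ← ↭.All-resp-↭ p hΔ = sound d (mono , h ∷ hΓ , hΔ′)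
sound (∨L _ p d e) (mono , hΓ , hΔ) with ↭.All-resp-↭ p hΓ
... | ⊩-∨ˡ h ∷ hΓ′ = sound d (mono , h ∷ hΓ′ , hΔ)
... | ⊩-∨ʳ h ∷ hΓ′ = sound e (mono , h ∷ hΓ′ , hΔ)
sound (∨R _ p d) (mono , hΓ , hΔ)
  with ⊮-∨ h h′ ∷ hΔ′ ← ↭.All-resp-↭ p hΔ = sound d (mono , hΓ , h ∷ h′ ∷ hΔ′)
sound (□L _ e □φ∈ d) (mono , hΓ , hΔ) =
  sound d (mono , proj₁ (□-elim (lookup hΓ □φ∈) (mono e)) ∷ hΓ , hΔ)
sound (4L _ e □φ∈ d) (mono , hΓ , hΔ) =
  sound d (mono , proj₂ (□-elim (lookup hΓ □φ∈) (mono e)) ∷ hΓ , hΔ)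
sound (□R _ p y∉ d) r@(_ , _ , hΔ)
  with ⊮-□ s≺ s⊮φ s⊩□φ ∷ _ ← ↭.All-resp-↭ p hΔ = sound d (□R-refutes p y∉ s≺ s⊮φ s⊩□φ r)

_≟ᶠ_ : DecidableEquality Fm
var p ≟ᶠ var q = map′ (cong var) (λ { refl → refl }) (p ≟ q)
(¬' φ) ≟ᶠ (¬' ψ) = map′ (cong ¬'_) (λ { refl → refl }) (φ ≟ᶠ ψ)
(φ ∨' ψ) ≟ᶠ (φ′ ∨' ψ′) = map′ (uncurry (cong₂ _∨'_)) (λ { refl → refl , refl }) (φ ≟ᶠ φ′ ×-dec ψ ≟ᶠ ψ′)
(□ φ) ≟ᶠ (□ ψ) = map′ (cong □_) (λ { refl → refl }) (φ ≟ᶠ ψ)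
var _ ≟ᶠ ¬' _ = no λ ()
var _ ≟ᶠ (_ ∨' _) = no λ ()
var _ ≟ᶠ □ _ = no λ ()
¬' _ ≟ᶠ var _ = no λ ()
¬' _ ≟ᶠ (_ ∨' _) = no λ ()
¬' _ ≟ᶠ □ _ = no λ ()
(_ ∨' _) ≟ᶠ var _ = no λ ()
(_ ∨' _) ≟ᶠ ¬' _ = no λ ()
(_ ∨' _) ≟ᶠ □ _ = no λ ()
□ _ ≟ᶠ var _ = no λ ()
□ _ ≟ᶠ ¬' _ = no λ ()
□ _ ≟ᶠ (_ ∨' _) = no λ ()

open import Data.List.Membership.DecPropositional _≟ᶠ_ using (_∈?_)

bodies : Fm → List Fm
bodies (var _) = []
bodies (¬' φ) = bodies φ
bodies (φ ∨' ψ) = bodies φ ++ bodies ψ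
bodies (□ φ) = φ ∷ bodies φ

unbox : List Fm → List Fm
unbox [] = []
unbox (□ φ ∷ Γ) = φ ∷ unbox Γ
unbox (var _ ∷ Γ) = unbox Γ
unbox (¬' _ ∷ Γ) = unbox Γ
unbox ((_ ∨' _) ∷ Γ) = unbox Γ

∈-unbox⁺ : ∀ {φ Γ} → □ φ ∈ Γ → φ ∈ unbox Γ
∈-unbox⁺ (here refl) = here refl
∈-unbox⁺ {Γ = □ _ ∷ _} (there m) = there (∈-unbox⁺ m)
∈-unbox⁺ {Γ = var _ ∷ _} (there m) = ∈-unbox⁺ m
∈-unbox⁺ {Γ = ¬' _ ∷ _} (there m) = ∈-unbox⁺ m
∈-unbox⁺ {Γ = (_ ∨' _) ∷ _} (there m) = ∈-unbox⁺ m

∈-unbox⁻ : ∀ {φ} Γ → φ ∈ unbox Γ → □ φ ∈ Γ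
∈-unbox⁻ (□ _ ∷ Γ) (here refl) = here refl
∈-unbox⁻ (□ _ ∷ Γ) (there m) = there (∈-unbox⁻ Γ m)
∈-unbox⁻ (var _ ∷ Γ) m = there (∈-unbox⁻ Γ m)
∈-unbox⁻ (¬' _ ∷ Γ) m = there (∈-unbox⁻ Γ m)
∈-unbox⁻ ((_ ∨' _) ∷ Γ) m = there (∈-unbox⁻ Γ m)

carry : List Fm → List Fm
carry [] = []
carry (φ ∷ Φ) = φ ∷ □ φ ∷ carry Φ

∈-carry : ∀ {φ Φ} → φ ∈ Φ → φ ∈ carry Φ × □ φ ∈ carry Φ
∈-carry (here refl) = here refl , there (here refl)
∈-carry (there m) = let φ∈ , □φ∈ = ∈-carry m in there (there φ∈) , there (there □φ∈)

carry-bodies : ∀ {Φ χ ψ} → χ ∈ carry Φ → ψ ∈ bodies χ → ∃ λ φ → φ ∈ Φ × ψ ∈ bodies (□ φ)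
carry-bodies {_ ∷ _} (here refl) ψ∈ = _ , here refl , there ψ∈
carry-bodies {_ ∷ _} (there (here refl)) ψ∈ = _ , here refl , ψ∈
carry-bodies {_ ∷ _} (there (there χ∈)) ψ∈ with φ , φ∈ , ψ∈′ ← carry-bodies χ∈ ψ∈ = φ , there φ∈ , ψ∈′

-- The antecedent at the fresh leaf after □R on □φ and after propagating every
-- □B in Γ with □L and 4L.
jump : List Fm → Fm → List Fm
jump Γ φ = carry (unbox Γ) ++ □ φ ∷ []

data Elementary : Fm → Set where
  atom  : ∀ {p} → Elementary (var p)
  boxed : ∀ {φ} → Elementary (□ φ)

data LocalView (Φ : List Fm) : Set where
  negation    : ∀ {φ Φ′} → Φ ↭ ¬' φ ∷ Φ′ → LocalView Φ
  disjunction : ∀ {φ ψ Φ′} → Φ ↭ (φ ∨' ψ) ∷ Φ′ → LocalView Φ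
  elementary  : All Elementary Φ → LocalView Φ

skip : ∀ {χ Φ} → Elementary χ → LocalView Φ → LocalView (χ ∷ Φ)
skip _ (negation p) = negation (↭-pull p)
skip _ (disjunction p) = disjunction (↭-pull p)
skip e (elementary es) = elementary (e ∷ es)

localView : ∀ Φ → LocalView Φ
localView [] = elementary []
localView (¬' φ ∷ Φ) = negation ↭-refl
localView ((φ ∨' ψ) ∷ Φ) = disjunction ↭-refl
localView (var p ∷ Φ) = skip atom (localView Φ)
localView (□ φ ∷ Φ) = skip boxed (localView Φ)

-- Boxes weigh nothing: they are never decomposed by local rules.
size : Fm → ℕ
size (var _) = 0
size (¬' φ) = suc (size φ)
size (φ ∨' ψ) = suc (size φ + size ψ)
size (□ _) = 0

∑ : List Fm → ℕ
∑ Φ = sum (map size Φ)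

weight : List Fm → List Fm → ℕ
weight Γ Δ = ∑ (Γ ++ Δ)

-- Each box body in the sequent is either still pending in R or already boxed
-- on the left, so a □R step on a □φ that is not on the left can remove φ from R.
Budget : List Fm → List Fm → List Fm → Set
Budget R Γ Δ = ∀ {χ φ} → χ ∈ Γ ++ Δ → φ ∈ bodies χ → φ ∈ R ⊎ □ φ ∈ Γ

record LocalPremise (Γ Δ Γ′ Δ′ : List Fm) : Set where
  field
    {principal}  : Fm
    {components} : List Fm
    {rest}       : List Fm
    before       : Γ ++ Δ ↭ principal ∷ rest
    after        : Γ′ ++ Δ′ ↭ components ++ rest
    smaller      : ∑ components < size principal
    subformulas  : All (λ ξ → bodies ξ ⊆ bodies principal) components
    boxes-kept   : ∀ {φ} → □ φ ∈ Γ → □ φ ∈ Γ′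

  lighter : weight Γ′ Δ′ < weight Γ Δ
  lighter = begin-strict
    weight Γ′ Δ′                               ≡⟨ sum-↭ (↭.map⁺ size after) ⟩
    sum (map size (components ++ rest))        ≡⟨ cong sum (map-++ size components rest) ⟩
    sum (map size components ++ map size rest) ≡⟨ sum-++ (map size components) _ ⟩
    ∑ components + ∑ rest                      <⟨ +-monoˡ-< (∑ rest) smaller ⟩
    size principal + ∑ rest                    ≡⟨ sum-↭ (↭.map⁺ size before) ⟨
    weight Γ Δ                                 ∎
    where open ≤-Reasoning

  budget : ∀ {R} → Budget R Γ Δ → Budget R Γ′ Δ′
  budget {R} inv {φ = φ} χ∈ φ∈ =
    Sum.map₂ boxes-kept (from-conclusion (∈-++⁻ components (↭.∈-resp-↭ after χ∈)))
    where
    from-conclusion : _ ⊎ _ → φ ∈ R ⊎ □ φ ∈ Γ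
    from-conclusion (inj₁ ξ∈) = inv (↭-head∈ before) (lookup subformulas ξ∈ φ∈)
    from-conclusion (inj₂ χ∈rest) = inv (↭.∈-resp-↭ (↭-sym before) (there χ∈rest)) φ∈

□-survives : ∀ {Γ Γ′ χ φ} → Γ ↭ χ ∷ Γ′ → (∀ {ψ} → χ ≢ □ ψ) → □ φ ∈ Γ → □ φ ∈ Γ′
□-survives p χ≢□ □φ∈ with ↭.∈-resp-↭ p □φ∈
... | here □φ≡χ = ⊥-elim (χ≢□ (sym □φ≡χ))
... | there □φ∈′ = □φ∈′

¬L-premise : ∀ {Γ Γ′ Δ φ} → Γ ↭ ¬' φ ∷ Γ′ → LocalPremise Γ Δ Γ′ (φ ∷ Δ)
¬L-premise {Γ′ = Γ′} {Δ} p = record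
  { before = left-principal p ; after = ↭.shift _ Γ′ Δ
  ; smaller = s≤s (≤-reflexive (+-identityʳ _)) ; subformulas = id ∷ []
  ; boxes-kept = □-survives p λ () }

∨L-premises : ∀ {Γ Γ′ Δ φ ψ} → Γ ↭ (φ ∨' ψ) ∷ Γ′ →
              LocalPremise Γ Δ (φ ∷ Γ′) Δ × LocalPremise Γ Δ (ψ ∷ Γ′) Δ
∨L-premises p =
  record { before = left-principal p ; after = ↭-refl
         ; smaller = s≤s (≤-trans (≤-reflexive (+-identityʳ _)) (m≤m+n _ _))
         ; subformulas = ∈-++⁺ˡ ∷ []
         ; boxes-kept = there ∘ □-survives p λ () } ,
  record { before = left-principal p ; after = ↭-refl
         ; smaller = s≤s (≤-trans (≤-reflexive (+-identityʳ _)) (m≤n+m _ _))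
         ; subformulas = ∈-++⁺ʳ _ ∷ []
         ; boxes-kept = there ∘ □-survives p λ () }

¬R-premise : ∀ {Γ Δ Δ′ φ} → Δ ↭ ¬' φ ∷ Δ′ → LocalPremise Γ Δ (φ ∷ Γ) Δ′
¬R-premise p = record
  { before = right-principal p ; after = ↭-refl
  ; smaller = s≤s (≤-reflexive (+-identityʳ _)) ; subformulas = id ∷ []
  ; boxes-kept = there }

∨R-premise : ∀ {Γ Δ Δ′ φ ψ} → Δ ↭ (φ ∨' ψ) ∷ Δ′ → LocalPremise Γ Δ Γ (φ ∷ ψ ∷ Δ′)
∨R-premise {Γ} {φ = φ} {ψ} p = record
  { before = right-principal p ; after = ↭.shifts Γ (φ ∷ ψ ∷ [])
  ; smaller = s≤s (≤-reflexive (cong (size φ +_) (+-identityʳ (size ψ))))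
  ; subformulas = ∈-++⁺ˡ ∷ ∈-++⁺ʳ _ ∷ []
  ; boxes-kept = id }

_─_ : List Fm → Fm → List Fm
R ─ φ = filter (λ ψ → ¬? (ψ ≟ᶠ φ)) R

─-shrinks : ∀ {R φ} → φ ∈ R → length (R ─ φ) < length R
─-shrinks {R} {φ} φ∈ = filter-notAll (λ ψ → ¬? (ψ ≟ᶠ φ)) R (Any.map (λ { refl φ≢φ → φ≢φ refl }) φ∈)

jump-budget : ∀ {R Γ Δ φ} → Budget R Γ Δ → □ φ ∈ Δ → Budget (R ─ φ) (jump Γ φ) (φ ∷ [])
jump-budget {R} {Γ} {φ = φ} inv □φ∈ {χ} {ψ} χ∈ ψ∈ = settle (origin (∈-++⁻ (jump Γ φ) χ∈))
  where
  origin : χ ∈ jump Γ φ ⊎ χ ∈ φ ∷ [] → ψ ∈ R ⊎ □ ψ ∈ Γ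
  origin (inj₁ χ∈jump) with ∈-++⁻ (carry (unbox Γ)) χ∈jump
  ... | inj₁ χ∈carry with θ , θ∈ , ψ∈□θ ← carry-bodies χ∈carry ψ∈ = inv (∈-++⁺ˡ (∈-unbox⁻ Γ θ∈)) ψ∈□θ
  ... | inj₂ (here refl) = inv (∈-++⁺ʳ Γ □φ∈) ψ∈
  origin (inj₂ (here refl)) = inv (∈-++⁺ʳ Γ □φ∈) (there ψ∈)
  settle : ψ ∈ R ⊎ □ ψ ∈ Γ → ψ ∈ R ─ φ ⊎ □ ψ ∈ jump Γ φ
  settle (inj₂ □ψ∈) = inj₂ (∈-++⁺ˡ (proj₂ (∈-carry (∈-unbox⁺ □ψ∈))))
  settle (inj₁ ψ∈R) with ψ ≟ᶠ φ
  ... | yes refl = inj₂ (∈-++⁺ʳ (carry (unbox Γ)) (here refl))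
  ... | no ψ≢φ = inj₁ (∈-filter⁺ (λ ψ → ¬? (ψ ≟ᶠ φ)) ψ∈R ψ≢φ)

Refutation : List Fm → List Fm → Set
Refutation Γ Δ = ∃ λ t → All (t ⊩_) Γ × All (t ⊮_) Δ

jump-refutation : ∀ {Γ φ} → Refutation (jump Γ φ) (φ ∷ []) →
                  ∃ λ t → All (t ⊩_) (carry (unbox Γ)) × t ⊮ φ × t ⊩ □ φ
jump-refutation {Γ} (t , ⊩jump , ⊮φ ∷ []) with ⊩□φ ∷ [] ← All.++⁻ʳ (carry (unbox Γ)) ⊩jump
  = t , All.++⁻ˡ (carry (unbox Γ)) ⊩jump , ⊮φ , ⊩□φ

gather : ∀ {A : Set} {G : Tree → Set} {R : A → Tree → Set} {as} →
         All (λ a → ∃ λ t → G t × R a t) as → ∃ λ ts → All G ts × All (λ a → Any (R a) ts) as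
gather [] = [] , [] , []
gather ((t , g , r) ∷ rs) with ts , gs , found ← gather rs =
  t ∷ ts , g ∷ gs , here r ∷ All.map there found

countermodel : ∀ {Γ Δ} → All Elementary Γ → All Elementary Δ → ¬ Any (_∈ Δ) Γ →
               All (λ φ → Refutation (jump Γ φ) (φ ∷ [])) (unbox Δ) → Refutation Γ Δ
countermodel {Γ} {Δ} eΓ eΔ disjoint children
  with ts , carried , witnesses ← gather (All.map (jump-refutation {Γ}) children)
  = root , tabulate (λ χ∈ → forced (lookup eΓ χ∈) χ∈) , tabulate (λ χ∈ → refuted (lookup eΔ χ∈) χ∈)
  where
  root = node (λ p → does (var p ∈? Γ)) ts
  forced : ∀ {χ} → Elementary χ → χ ∈ Γ → root ⊩ χ
  forced atom χ∈ = ⊩-var (dec-true (_ ∈? Γ) χ∈)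
  forced boxed χ∈ with φ∈ , □φ∈ ← ∈-carry (∈-unbox⁺ χ∈) =
    ⊩-□ (All.map (λ ⊩c → lookup ⊩c φ∈ , lookup ⊩c □φ∈) carried)
  refuted : ∀ {χ} → Elementary χ → χ ∈ Δ → root ⊮ χ
  refuted atom χ∈ = ⊮-var (dec-false (_ ∈? Γ) λ χ∈Γ → disjoint (lose χ∈Γ χ∈))
  refuted boxed χ∈ with _ , t∈ , ⊮φ , ⊩□φ ← find (lookup witnesses (∈-unbox⁺ χ∈)) =
    ⊮-□ (child t∈) ⊮φ ⊩□φ

-- Chains of labels

module Chain (x : Label) where

  top : ℕ → Label
  top k = k + x

  chain : ℕ → List RAtom
  chain zero = []
  chain (suc k) = (top k , top (suc k)) ∷ chain k

  InRange : ℕ → Label → Set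
  InRange k l = x ≤ l × l ≤ top k

  chain-edge⁻ : ∀ {k a b} → (a , b) ∈ chain k → b ≡ suc a × x ≤ a × b ≤ top k
  chain-edge⁻ {suc k} (here refl) = refl , m≤n+m x k , ≤-refl
  chain-edge⁻ {suc k} (there e) with b≡ , x≤a , b≤ ← chain-edge⁻ e = b≡ , x≤a , m≤n⇒m≤1+n b≤

  chain-edge⁺ : ∀ {k a} → x ≤ a → suc a ≤ top k → (a , suc a) ∈ chain k
  chain-edge⁺ {zero} x≤a a<x = ⊥-elim (1+n≰n (≤-trans a<x x≤a))
  chain-edge⁺ {suc k} {a} x≤a (s≤s a≤top) with a ≟ top k
  ... | yes refl = here refl
  ... | no a≢top = there (chain-edge⁺ x≤a (≤∧≢⇒< a≤top a≢top))

  vertex-range : ∀ k {v} → v ∈ vertices (chain k) → InRange k v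
  vertex-range k v∈ with ∈-vertices⁻ (chain k) v∈
  ... | _ , inj₁ e with refl , x≤v , v<b ← chain-edge⁻ e = x≤v , <⇒≤ v<b
  ... | _ , inj₂ e with refl , x≤a , v≤ ← chain-edge⁻ e = m≤n⇒m≤1+n x≤a , v≤

  range-vertex : ∀ {k v} → InRange (suc k) v → v ∈ vertices (chain (suc k))
  range-vertex {k} (x≤v , v≤) with m≤n⇒m<n∨m≡n x≤v
  ... | inj₂ refl = source∈vertices (chain-edge⁺ ≤-refl (s≤s (m≤n+m x k)))
  ... | inj₁ (s≤s x≤u) = target∈vertices (chain-edge⁺ x≤u v≤)

  reach-chain : ∀ {k v} → x ≤′ v → v ≤ top k → Reach (chain k) x v
  reach-chain (≤′-reflexive refl) _ = here
  reach-chain (≤′-step x≤′u) v≤ = reach-snoc (reach-chain x≤′u (<⇒≤ v≤)) (chain-edge⁺ (≤′⇒≤ x≤′u) v≤)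

  chain-tree : ∀ k → IsTree (chain k)
  chain-tree zero = inj₁ refl
  chain-tree (suc k) = inj₂ (x , range-vertex (≤-refl , m≤n+m x (suc k)) , root , parent , reach)
    where
    root : ∀ u → (u , x) ∉ chain (suc k)
    root u e with refl , x≤u , _ ← chain-edge⁻ e = 1+n≰n x≤u
    parent : ∀ v → v ∈ vertices (chain (suc k)) → v ≢ x →
             ∃ λ u → (u , v) ∈ chain (suc k) × (∀ u′ → (u′ , v) ∈ chain (suc k) → u′ ≡ u)
    parent v v∈ v≢x with x≤v , v≤ ← vertex-range (suc k) v∈ | ≤∧≢⇒< x≤v (v≢x ∘ sym)
    ... | s≤s x≤u = _ , chain-edge⁺ x≤u v≤ , λ _ e → sym (suc-injective (proj₁ (chain-edge⁻ e)))
    reach : ∀ v → v ∈ vertices (chain (suc k)) → Reach (chain (suc k)) x v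
    reach v v∈ with x≤v , v≤ ← vertex-range (suc k) v∈ = reach-chain (≤⇒≤′ x≤v) v≤

  chain-treeSeq : ∀ k Γ Δ → All (InRange k) (map lab (Γ ++ Δ)) → IsTreeSeq ⟨ chain k , Γ ⊢ Δ ⟩
  chain-treeSeq zero _ _ h =
    inj₁ refl , (λ []≢[] → ⊥-elim ([]≢[] refl)) , λ _ a b a∈ b∈ → trans (at-root a∈) (sym (at-root b∈))
    where
    at-root : ∀ {l} → l ∈ map lab _ → l ≡ x
    at-root l∈ with x≤l , l≤x ← lookup h l∈ = ≤-antisym l≤x x≤l
  chain-treeSeq (suc k) _ _ h = chain-tree (suc k) , (λ _ → All.map range-vertex h) , λ ()

  top-childless : ∀ k {y} → (top k , y) ∉ chain k
  top-childless k e with refl , _ , top<top ← chain-edge⁻ e = 1+n≰n top<top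

  top-leaf-suc : ∀ k Γ Δ → IsLeaf ⟨ chain (suc k) , Γ ⊢ Δ ⟩ (top (suc k))
  top-leaf-suc k _ _ = inj₁ (target∈vertices {chain (suc k)} (here refl) , λ _ → top-childless (suc k))

  top-leaf : ∀ k Γ Δ → top k ∈ map lab (Γ ++ Δ) → IsLeaf ⟨ chain k , Γ ⊢ Δ ⟩ (top k)
  top-leaf zero _ _ top∈ = inj₂ (refl , top∈)
  top-leaf (suc k) Γ Δ _ = top-leaf-suc k Γ Δ

  top-preleaf : ∀ k Γ Δ → IsPreLeaf ⟨ chain (suc k) , Γ ⊢ Δ ⟩ (top k)
  top-preleaf k Γ Δ y e with refl , _ ← chain-edge⁻ e = top-leaf-suc k Γ Δ

  top-fresh : ∀ k Γ Δ → All (InRange k) (map lab (Γ ++ Δ)) → ¬ Occurs (top (suc k)) ⟨ chain k , Γ ⊢ Δ ⟩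
  top-fresh k _ _ h (inj₁ v∈) = 1+n≰n (proj₂ (vertex-range k v∈))
  top-fresh k _ _ h (inj₂ l∈) = 1+n≰n (proj₂ (lookup h l∈))

-- End-active proof search

EndActiveProof : Seq → Set
EndActiveProof S = Σ (Proof S) EndActive

module Search (x : Label) where
  open Chain x

  -- The search state at depth k: the relational part is the chain from x to top k,
  -- the formulas being decomposed sit at the leaf top k, and the dead ones, at
  -- earlier labels, are never principal again.
  record Frame (k : ℕ) : Set where
    constructor frame
    field
      deadΓ deadΔ : List LFm
      deadΓ-range : All (InRange k ∘ lab) deadΓ
      deadΔ-range : All (InRange k ∘ lab) deadΔ
  open Frame

  antecedent succedent : ∀ {k} → Frame k → List Fm → List LFm
  antecedent {k} F Γ = map (top k ∶_) Γ ++ deadΓ F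
  succedent {k} F Δ = map (top k ∶_) Δ ++ deadΔ F

  _⟪_⊢_⟫ : ∀ {k} → Frame k → List Fm → List Fm → Seq
  _⟪_⊢_⟫ {k} F Γ Δ = ⟨ chain k , antecedent F Γ ⊢ succedent F Δ ⟩

  Outcome : ∀ {k} → Frame k → List Fm → List Fm → Set
  Outcome F Γ Δ = EndActiveProof (F ⟪ Γ ⊢ Δ ⟫) ⊎ Refutation Γ Δ

  active-range : ∀ k Φ → All (InRange k ∘ lab) (map (top k ∶_) Φ)
  active-range k Φ = All.map⁺ (All.universal (λ _ → m≤n+m x k , ≤-refl) Φ)

  labels-range : ∀ {k} (F : Frame k) Γ Δ → All (InRange k) (labels (F ⟪ Γ ⊢ Δ ⟫))
  labels-range {k} F Γ Δ = All.map⁺ (All.++⁺ (All.++⁺ (active-range k Γ) (deadΓ-range F))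
                                              (All.++⁺ (active-range k Δ) (deadΔ-range F)))

  tree-seq : ∀ {k} (F : Frame k) Γ Δ → IsTreeSeq (F ⟪ Γ ⊢ Δ ⟫)
  tree-seq {k} F Γ Δ = chain-treeSeq k (antecedent F Γ) (succedent F Δ) (labels-range F Γ Δ)

  push : ∀ {k} → Frame k → List Fm → List Fm → Frame (suc k)
  push {k} F Γ Δ = frame _ _ (widen (All.++⁺ (active-range k Γ) (deadΓ-range F)))
                             (widen (All.++⁺ (active-range k Δ) (deadΔ-range F)))
    where
    widen : ∀ {D : List LFm} → All (InRange k ∘ lab) D → All (InRange (suc k) ∘ lab) D
    widen = All.map λ (x≤l , l≤top) → x≤l , m≤n⇒m≤1+n l≤top

  lift-∈ : ∀ {k χ Φ} D → χ ∈ Φ → (top k ∶ χ) ∈ map (top k ∶_) Φ ++ D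
  lift-∈ D χ∈ = ∈-++⁺ˡ (∈-map⁺ _ χ∈)

  lift-↭ : ∀ {k χ Φ Φ′} D → Φ ↭ χ ∷ Φ′ → map (top k ∶_) Φ ++ D ↭ (top k ∶ χ) ∷ map (top k ∶_) Φ′ ++ D
  lift-↭ D p = ↭.++⁺ʳ D (↭.map⁺ _ p)

  lift-∈↭ : ∀ {k χ Φ} D → χ ∈ Φ → ∃ λ rest → map (top k ∶_) Φ ++ D ↭ (top k ∶ χ) ∷ rest
  lift-∈↭ D = ∈⇒↭ ∘ lift-∈ D

  leafΓ : ∀ {k} (F : Frame k) {Γ} Δ {χ} → χ ∈ Γ → IsLeaf (F ⟪ Γ ⊢ Δ ⟫) (top k)
  leafΓ {k} F {Γ} Δ χ∈ =
    top-leaf k (antecedent F Γ) (succedent F Δ) (∈-map⁺ lab (∈-++⁺ˡ (lift-∈ (deadΓ F) χ∈)))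

  leafΔ : ∀ {k} (F : Frame k) Γ {Δ χ} → χ ∈ Δ → IsLeaf (F ⟪ Γ ⊢ Δ ⟫) (top k)
  leafΔ {k} F Γ {Δ} χ∈ = top-leaf k Γs (succedent F Δ) (∈-map⁺ lab (∈-++⁺ʳ Γs (lift-∈ (deadΔ F) χ∈)))
    where Γs = antecedent F Γ

  axiom : ∀ {k} (F : Frame k) {Γ Δ χ} → Elementary χ → χ ∈ Γ → χ ∈ Δ → EndActiveProof (F ⟪ Γ ⊢ Δ ⟫)
  axiom F {Γ} {Δ} atom χ∈Γ χ∈Δ =
    id₁ (tree-seq F Γ Δ) (proj₂ (lift-∈↭ (deadΓ F) χ∈Γ)) (proj₂ (lift-∈↭ (deadΔ F) χ∈Δ)) , leafΓ F Δ χ∈Γ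
  axiom F {Γ} {Δ} boxed χ∈Γ χ∈Δ =
    id₂ (tree-seq F Γ Δ) (proj₂ (lift-∈↭ (deadΓ F) χ∈Γ)) (proj₂ (lift-∈↭ (deadΔ F) χ∈Δ)) , leafΓ F Δ χ∈Γ

  ¬L-step : ∀ {k} (F : Frame k) {Γ Γ′ Δ φ} → Γ ↭ ¬' φ ∷ Γ′ → Outcome F Γ′ (φ ∷ Δ) → Outcome F Γ Δ
  ¬L-step F {Γ} {Δ = Δ} p (inj₁ (d , ea)) =
    inj₁ (¬L (tree-seq F Γ Δ) (lift-↭ (deadΓ F) p) d , leafΓ F Δ (↭-head∈ p) , ea)
  ¬L-step F p (inj₂ (t , ⊩Γ′ , ⊮φ ∷ ⊮Δ)) = inj₂ (t , ↭.All-resp-↭ (↭-sym p) (⊩-¬ ⊮φ ∷ ⊩Γ′) , ⊮Δ)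

  ∨L-step : ∀ {k} (F : Frame k) {Γ Γ′ Δ φ ψ} → Γ ↭ (φ ∨' ψ) ∷ Γ′ →
            Outcome F (φ ∷ Γ′) Δ → Outcome F (ψ ∷ Γ′) Δ → Outcome F Γ Δ
  ∨L-step F {Γ} {Δ = Δ} p (inj₁ (d , ea)) (inj₁ (e , eb)) =
    inj₁ (∨L (tree-seq F Γ Δ) (lift-↭ (deadΓ F) p) d e , leafΓ F Δ (↭-head∈ p) , ea , eb)
  ∨L-step F p (inj₂ (t , ⊩φ ∷ ⊩Γ′ , ⊮Δ)) _ =
    inj₂ (t , ↭.All-resp-↭ (↭-sym p) (⊩-∨ˡ ⊩φ ∷ ⊩Γ′) , ⊮Δ)
  ∨L-step F p (inj₁ _) (inj₂ (t , ⊩ψ ∷ ⊩Γ′ , ⊮Δ)) =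
    inj₂ (t , ↭.All-resp-↭ (↭-sym p) (⊩-∨ʳ ⊩ψ ∷ ⊩Γ′) , ⊮Δ)

  ¬R-step : ∀ {k} (F : Frame k) {Γ Δ Δ′ φ} → Δ ↭ ¬' φ ∷ Δ′ → Outcome F (φ ∷ Γ) Δ′ → Outcome F Γ Δ
  ¬R-step F {Γ} {Δ} p (inj₁ (d , ea)) =
    inj₁ (¬R (tree-seq F Γ Δ) (lift-↭ (deadΔ F) p) d , leafΔ F Γ (↭-head∈ p) , ea)
  ¬R-step F p (inj₂ (t , ⊩φ ∷ ⊩Γ , ⊮Δ′)) = inj₂ (t , ⊩Γ , ↭.All-resp-↭ (↭-sym p) (⊮-¬ ⊩φ ∷ ⊮Δ′))

  ∨R-step : ∀ {k} (F : Frame k) {Γ Δ Δ′ φ ψ} → Δ ↭ (φ ∨' ψ) ∷ Δ′ →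
            Outcome F Γ (φ ∷ ψ ∷ Δ′) → Outcome F Γ Δ
  ∨R-step F {Γ} {Δ} p (inj₁ (d , ea)) =
    inj₁ (∨R (tree-seq F Γ Δ) (lift-↭ (deadΔ F) p) d , leafΔ F Γ (↭-head∈ p) , ea)
  ∨R-step F p (inj₂ (t , ⊩Γ , ⊮φ ∷ ⊮ψ ∷ ⊮Δ′)) =
    inj₂ (t , ⊩Γ , ↭.All-resp-↭ (↭-sym p) (⊮-∨ ⊮φ ⊮ψ ∷ ⊮Δ′))

  propagate : ∀ {k} (G : Frame (suc k)) Φ {Θ Δ} → (∀ {φ} → φ ∈ Φ → (top k ∶ □ φ) ∈ deadΓ G) →
              EndActiveProof (G ⟪ carry Φ ++ Θ ⊢ Δ ⟫) → EndActiveProof (G ⟪ Θ ⊢ Δ ⟫)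
  propagate G [] _ d = d
  propagate {k} G (φ ∷ Φ) {Θ} {Δ} old (d , ea) =
    propagate G Φ (old ∘ there)
      (4L (tree-seq G Γ₀ Δ) (here refl) (∈-++⁺ʳ _ (old (here refl)))
          (□L (tree-seq G (□ φ ∷ Γ₀) Δ) (here refl) (there (∈-++⁺ʳ _ (old (here refl)))) d) ,
       top-preleaf k (Γs Γ₀) Δs , top-leaf-suc k (Γs Γ₀) Δs ,
       top-preleaf k (Γs (□ φ ∷ Γ₀)) Δs , top-leaf-suc k (Γs (□ φ ∷ Γ₀)) Δs , ea)
    where
    Γ₀ = carry Φ ++ Θ
    Γs = antecedent G
    Δs = succedent G Δ

  □R-step : ∀ {k} (F : Frame k) {Γ Δ Δ′ φ} → Δ ↭ □ φ ∷ Δ′ →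
            EndActiveProof (push F Γ Δ′ ⟪ jump Γ φ ⊢ φ ∷ [] ⟫) → EndActiveProof (F ⟪ Γ ⊢ Δ ⟫)
  □R-step {k} F {Γ} {Δ} {Δ′} {φ} p d
    with d′ , ea ← propagate (push F Γ Δ′) (unbox Γ) {Δ = φ ∷ []} (∈-++⁺ˡ ∘ ∈-map⁺ _ ∘ ∈-unbox⁻ Γ) d
    = □R (tree-seq F Γ Δ) (lift-↭ (deadΔ F) p) fresh d′ , ea
    where fresh = top-fresh k (antecedent F Γ) (succedent F Δ) (labels-range F Γ Δ)

  search : ∀ {k} (F : Frame k) R Γ Δ → Acc _<_ (length R) → Budget R Γ Δ → Outcome F Γ Δ
  decompose : ∀ {k} (F : Frame k) R Γ Δ → Acc _<_ (length R) → Budget R Γ Δ →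
              Acc _<_ (weight Γ Δ) → Outcome F Γ Δ
  saturated : ∀ {k} (F : Frame k) R Γ Δ → Acc _<_ (length R) → Budget R Γ Δ →
              All Elementary Γ → All Elementary Δ → Outcome F Γ Δ

  search F R Γ Δ accR inv = decompose F R Γ Δ accR inv (<-wellFounded (weight Γ Δ))

  decompose F R Γ Δ accR inv (acc rs) = by-view (localView Γ) (localView Δ)
    where
    premise : ∀ {Γ′ Δ′} → LocalPremise Γ Δ Γ′ Δ′ → Outcome F Γ′ Δ′
    premise P = decompose F R _ _ accR (LocalPremise.budget P inv) (rs (LocalPremise.lighter P))
    by-view : LocalView Γ → LocalView Δ → Outcome F Γ Δ
    by-view (negation p) _ = ¬L-step F p (premise (¬L-premise p))
    by-view (disjunction p) _ = let Pφ , Pψ = ∨L-premises p in ∨L-step F p (premise Pφ) (premise Pψ)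
    by-view (elementary _) (negation p) = ¬R-step F p (premise (¬R-premise p))
    by-view (elementary _) (disjunction p) = ∨R-step F p (premise (∨R-premise p))
    by-view (elementary eΓ) (elementary eΔ) = saturated F R Γ Δ accR inv eΓ eΔ

  saturated F R Γ Δ (acc rs) inv eΓ eΔ with any? (_∈? Δ) Γ
  ... | yes shared = let _ , χ∈Γ , χ∈Δ = find shared in inj₁ (axiom F (lookup eΓ χ∈Γ) χ∈Γ χ∈Δ)
  ... | no disjoint = Sum.map₂ (countermodel eΓ eΔ disjoint) (all-or-escape (unbox Δ) jump-from)
    where
    jump-from : ∀ {φ} → φ ∈ unbox Δ → EndActiveProof (F ⟪ Γ ⊢ Δ ⟫) ⊎ Refutation (jump Γ φ) (φ ∷ [])
    jump-from {φ} φ∈ with Δ′ , p ← ∈⇒↭ (∈-unbox⁻ Δ φ∈) =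
      Sum.map₁ (□R-step F p)
        (search (push F Γ Δ′) (R ─ φ) (jump Γ φ) (φ ∷ []) (rs (─-shrinks pending)) (jump-budget inv □φ∈))
      where
      □φ∈ = ∈-unbox⁻ Δ φ∈
      pending : φ ∈ R
      pending with inv (∈-++⁺ʳ Γ □φ∈) (here refl)
      ... | inj₁ φ∈R = φ∈R
      ... | inj₂ □φ∈Γ = ⊥-elim (disjoint (lose □φ∈Γ □φ∈))

theorem4p6 : ∀ (x : Label) (φ : Fm) →
    Proof ⟨ [] , [] ⊢ (x ∶ φ) ∷ [] ⟩ →
    Σ (Proof ⟨ [] , [] ⊢ (x ∶ φ) ∷ [] ⟩) EndActive
theorem4p6 x φ d
  with Search.search x (Search.frame [] [] [] []) (bodies φ) [] (φ ∷ []) (<-wellFounded _)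
                     (λ { (here refl) → inj₁ })
... | inj₁ end-active = end-active
... | inj₂ (t , [] , t⊮φ ∷ []) = ⊥-elim (sound {f = λ _ → t} d ((λ ()) , [] , t⊮φ ∷ []))
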